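{- Let $s$ be a string of length $n$ whose last letter is a unique smallest letter $\$$, let $p'$ be an irreducible position of $s$, and consider the tree $I_{p'}$. Let $x$ be the node of $I_{p'}$ associated with a non-irreducible position $p > p'$, let $s[r..n-1]$ be the closest irreducible lexicographical neighbour of $s[p..n-1]$, and let $c_p = \mathrm{lcp}(r,p)$. Then the subtree of $I_{p'}$ rooted at $x$ coincides (as a rooted tree with node weights) with the tree obtained from $I_r$ by removing all children of the root of $I_r$ whose weights are $\ge c_p$ (together with their subtrees), then increasing all weights by $p - p'$, and finally setting the weight of the root to the weight of $x$.
   Context: $\mathrm{SA}$ is the suffix array of $s$, $\mathrm{ISA}$ its inverse, $\mathrm{lcp}(p,q)$ the length of the longest common prefix of $s[p..n-1]$ and $s[q..n-1]$, $\mathrm{LCP}[0]=0$, $\mathrm{LCP}[i]=\mathrm{lcp}(\mathrm{SA}[i-1],\mathrm{SA}[i])$, $\mathrm{PLCP}[p]=\mathrm{LCP}[\mathrm{ISA}[p]]$, $\ell_p=\mathrm{PLCP}[p]$. $\mathrm{BWT}[i] = s[\mathrm{SA}[i]-1]$ if $\mathrm{SA}[i]\ne0$, else $s[n-1]$. An index $i$ is irreducible if $i=0$ or $\mathrm{BWT}[i-1]\ne\mathrm{BWT}[i]$; a position $p$ is irreducible if $\mathrm{ISA}[p]$ is irreducible. With $R_{\le}[i]=\max\{j\le i: j\text{ irreducible}\}$ and $R_{\ge}[i]=\min\{j\ge i: j\text{ irreducible}\}$ (possibly undefined), the closest irreducible lexicographical neighbour of $s[p..n-1]$ is $s[r..n-1]$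 with $r=\mathrm{SA}[R_{\le}[\mathrm{ISA}[p]]]$ if $R_{\ge}[\mathrm{ISA}[p]]$ is undefined or $\mathrm{lcp}(\mathrm{SA}[R_{\le}[\mathrm{ISA}[p]]],p)\ge \mathrm{lcp}(\mathrm{SA}[R_{\ge}[\mathrm{ISA}[p]]],p)$, and $r=\mathrm{SA}[R_{\ge}[\mathrm{ISA}[p]]]$ otherwise. For a non-irreducible position $p$, $c_p = \mathrm{lcp}(r,p)$ with $r$ as just defined; for an irreducible position $p'$, $c_{p'} = \ell_{p'}$. For an irreducible position $p'$, let $p''$ be the next irreducible position after $p'$ (or $p''=n$ if there is none). The tree $I_{p'}$ has one node for each position in $[p'..p''-1]$; the root is associated with $p'$ and has weight $w_{p'} = +\infty$; a node associated with $r \ne p'$ has weight $w_r = r - p' + c_r$, and its parent is the node associated with $\max\{r' < r : w_{r'} > w_r\}$. -}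

module Defs where

open import Data.Nat using (ℕ; zero; suc; _+_; _∸_; _≤_; _<_; _<ᵇ_; _≡ᵇ_; _≤ᵇ_)
open import Data.Bool using (Bool; true; false; if_then_else_; _∨_; _∧_; not)
open import Data.List using (List; []; _∷_; length; drop)
open import Data.Maybe using (Maybe; just; nothing)
open import Data.Product using (_×_)
open import Data.Unit using (⊤)
open import Relation.Binary.PropositionalEquality using (_≡_; _≢_)
open import Relation.Nullary using (¬_)

-- Strings are lists over the ordered alphabet ℕ.
-- s[i] (default 0 out of range; never used out of range)
at : List ℕ → ℕ → ℕ
at []       _       = 0
at (x ∷ xs) zero    = x
at (x ∷ xs) (suc i) = at xs i

lexLt : List ℕ → List ℕ → Bool
lexLt []       []       = false
lexLt []       (_ ∷ _)  = true
lexLt (_ ∷ _)  []       = false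
lexLt (x ∷ xs) (y ∷ ys) = (x <ᵇ y) ∨ ((x ≡ᵇ y) ∧ lexLt xs ys)

lcpL : List ℕ → List ℕ → ℕ
lcpL (x ∷ xs) (y ∷ ys) = if x ≡ᵇ y then suc (lcpL xs ys) else 0
lcpL _        _        = 0

countBelow : ℕ → (ℕ → Bool) → ℕ
countBelow zero    P = 0
countBelow (suc k) P = (if P k then 1 else 0) + countBelow k P

leastFrom : ℕ → ℕ → (ℕ → Bool) → ℕ → ℕ
leastFrom i zero     P d = d
leastFrom i (suc f)  P d = if P i then i else leastFrom (suc i) f P d

leastFromM : ℕ → ℕ → (ℕ → Bool) → Maybe ℕ
leastFromM i zero    P = nothing
leastFromM i (suc f) P = if P i then just i else leastFromM (suc i) f P

data W : Set where
  fin : ℕ → W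
  ∞   : W

gtW : W → W → Bool
gtW ∞       (fin _) = true
gtW ∞       ∞       = false
gtW (fin _) ∞       = false
gtW (fin a) (fin b) = b <ᵇ a

_≥W_ : W → ℕ → Set
∞     ≥W c = ⊤
fin a ≥W c = c ≤ a

addW : ℕ → W → W
addW d (fin a) = fin (d + a)
addW d ∞       = ∞

module _ (s : List ℕ) where

  len : ℕ
  len = length s

  suf : ℕ → List ℕ
  suf p = drop p s

  lcp : ℕ → ℕ → ℕ
  lcp p q = lcpL (suf p) (suf q)

  ISA : ℕ → ℕ
  ISA p = countBelow len (λ q → lexLt (suf q) (suf p))

  SA : ℕ → ℕ
  SA i = leastFrom 0 len (λ p → ISA p ≡ᵇ i) 0

  LCP : ℕ → ℕ
  LCP zero    = 0
  LCP (suc i) = lcp (SA i) (SA (suc i))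

  PLCP : ℕ → ℕ
  PLCP p = LCP (ISA p)

  BWT : ℕ → ℕ
  BWT i = if SA i ≡ᵇ 0 then at s (len ∸ 1) else at s (SA i ∸ 1)

  irrIdx : ℕ → Bool
  irrIdx zero    = true
  irrIdx (suc i) = not (BWT i ≡ᵇ BWT (suc i))

  irrPos : ℕ → Bool
  irrPos p = irrIdx (ISA p)

  Rle : ℕ → ℕ
  Rle zero    = 0
  Rle (suc i) = if irrIdx (suc i) then suc i else Rle i

  Rge : ℕ → Maybe ℕ
  Rge i = leastFromM i (len ∸ i) irrIdx

  closest : ℕ → ℕ
  closest p with Rge (ISA p)
  ... | nothing = SA (Rle (ISA p))
  ... | just j  = if lcp (SA j) p ≤ᵇ lcp (SA (Rle (ISA p))) p
                    then SA (Rle (ISA p)) else SA j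

  cval : ℕ → ℕ
  cval p = if irrPos p then PLCP p else lcp (closest p) p

  nextIrr : ℕ → ℕ
  nextIrr p' = leastFrom (suc p') (len ∸ suc p') irrPos len

  wt : ℕ → ℕ → W
  wt p' q = if q ≡ᵇ p' then ∞ else fin (q ∸ p' + cval q)

  parentI : ℕ → ℕ → ℕ
  parentI p' q = go (q ∸ p')
    where
    go : ℕ → ℕ
    go zero    = p'
    go (suc k) = if gtW (wt p' (p' + k)) (wt p' q) then p' + k else go k

record WTree : Set₁ where
  field
    Node   : ℕ → Set
    root   : ℕ
    parent : ℕ → ℕ
    weight : ℕ → W

open WTree public

I : List ℕ → ℕ → WTree
I s p' = record
  { Node   = λ q → p' ≤ q × q < nextIrr s p'
  ; root   = p'
  ; parent = parentI s p'
  ; weight = wt s p'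
  }

data Desc (T : WTree) (x : ℕ) : ℕ → Set where
  here : Desc T x x
  step : ∀ {q} → Node T q → q ≢ root T → Desc T x (parent T q) → Desc T x q

subtree : WTree → ℕ → WTree
subtree T x = record
  { Node   = λ q → Node T q × Desc T x q
  ; root   = x
  ; parent = parent T
  ; weight = weight T
  }

prune : WTree → ℕ → ℕ → W → WTree
prune T c d rw = record
  { Node   = λ q → Node T q ×
               (∀ y → Node T y → y ≢ root T → parent T y ≡ root T →
                  weight T y ≥W c → ¬ Desc T y q)
  ; root   = root T
  ; parent = parent T
  ; weight = λ q → if q ≡ᵇ root T then rw else addW d (weight T q)
  }

record Iso (T U : WTree) : Set where
  field
    f      : ℕ → ℕ
    g      : ℕ → ℕ
    f-node : ∀ v → Node T v → Node U (f v)
    g-node : ∀ v → Node U v → Node T (g v)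
    gf     : ∀ v → Node T v → g (f v) ≡ v
    fg     : ∀ v → Node U v → f (g v) ≡ v
    f-root : f (root T) ≡ root U
    f-par  : ∀ v → Node T v → v ≢ root T → parent U (f v) ≡ f (parent T v)
    f-wt   : ∀ v → Node T v → weight U (f v) ≡ weight T v

module Submission where

-- Let r be the closest irreducible neighbour of p and c = lcp(r, p) = c_p. A position p + j
-- lies in the subtree of p in I_{p′} iff i + c_{p+i} < c for all 0 < i ≤ j. In that case
-- s[p+i..] and s[r+i..] share more than c_{p+i} letters, while no irreducible suffix shares
-- more than c_{p+i} with s[p+i..]; so r + i is reducible too, and since the two suffixes share
-- more than either c-value, c_{r+i} = c_{p+i}. The same holds with p and r exchanged. Hence
-- offsets from p in I_{p′} and offsets from r in I_r carry the same weights up to the shift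
-- p − p′, the parent relation (previous heavier position) is preserved, and the offsets
-- reachable from r are exactly those avoiding root children of weight ≥ c.

open import Defs
open import Data.Bool using (Bool; true; false; T; if_then_else_)
open import Data.Bool.Properties using (T-≡)
open import Data.Empty using (⊥-elim)
open import Data.Fin using (Fin; toℕ; fromℕ<; punchOut)
open import Data.Fin.Properties using (pigeonhole; punchOut-injective; toℕ-fromℕ<; toℕ<n; toℕ-injective)
open import Data.List using (List; []; _∷_; length; drop)
open import Data.List.Properties using (length-drop; drop-drop)
open import Data.List.Relation.Binary.Lex.Strict using (Lex-<; halt; this; next; <-irreflexive; <-transitive; <-compare)
open import Data.List.Relation.Binary.Pointwise using (Pointwise-≡⇒≡; ≡⇒Pointwise-≡)
open import Data.Maybe using (just; nothing)
open import Data.Nat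
open import Data.Nat.Induction using (<-wellFounded)
open import Induction.WellFounded using (Acc; acc)
open import Data.Nat.Properties
import Data.Product as Product
open import Data.Product using (_×_; _,_; proj₁; proj₂; Σ-syntax; ∃)
open import Data.Sum using (_⊎_; inj₁; inj₂)
open import Function using (_∘_)
open import Function.Bundles using (Equivalence)
open import Relation.Binary.Definitions using (Trichotomous; tri<; tri≈; tri>)
open import Relation.Binary.PropositionalEquality
open import Relation.Nullary using (¬_; yes; no; contradiction)

bool-clash : ∀ {A : Set} {b} → b ≡ true → b ≡ false → A
bool-clash refl ()

Bool-separates : ∀ {A : Set} (f : A → Bool) {a b} → f a ≡ true → f b ≡ false → a ≢ b
Bool-separates f fa fb refl = bool-clash fa fb

¬T⇒≡false : ∀ {b} → ¬ T b → b ≡ false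
¬T⇒≡false {false} _ = refl
¬T⇒≡false {true} ¬t = contradiction _ ¬t

<ᵇ-true : ∀ {a b} → a < b → (a <ᵇ b) ≡ true
<ᵇ-true = Equivalence.to T-≡ ∘ <⇒<ᵇ

<ᵇ-false : ∀ {a b} → b ≤ a → (a <ᵇ b) ≡ false
<ᵇ-false {a} {b} b≤a = ¬T⇒≡false (λ t → <⇒≱ (<ᵇ⇒< a b t) b≤a)

<ᵇ-true⁻¹ : ∀ {a b} → (a <ᵇ b) ≡ true → a < b
<ᵇ-true⁻¹ {a} {b} = <ᵇ⇒< a b ∘ Equivalence.from T-≡

<ᵇ-+-cancelˡ : ∀ d x y → (d + x <ᵇ d + y) ≡ (x <ᵇ y)
<ᵇ-+-cancelˡ zero    x y = refl
<ᵇ-+-cancelˡ (suc d) x y = <ᵇ-+-cancelˡ d x y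

<ᵇ-false⁻¹ : ∀ {a b} → (a <ᵇ b) ≡ false → b ≤ a
<ᵇ-false⁻¹ e = ≮⇒≥ λ a<b → bool-clash (<ᵇ-true a<b) e

≡ᵇ-true : ∀ {a b} → a ≡ b → (a ≡ᵇ b) ≡ true
≡ᵇ-true {a} {b} = Equivalence.to T-≡ ∘ ≡⇒≡ᵇ a b

≡ᵇ-false : ∀ {a b} → a ≢ b → (a ≡ᵇ b) ≡ false
≡ᵇ-false {a} {b} a≢b = ¬T⇒≡false (a≢b ∘ ≡ᵇ⇒≡ a b)

≡ᵇ-true⁻¹ : ∀ {a b} → (a ≡ᵇ b) ≡ true → a ≡ b
≡ᵇ-true⁻¹ {a} {b} = ≡ᵇ⇒≡ a b ∘ Equivalence.from T-≡

≤ᵇ-true⁻¹ : ∀ {a b} → (a ≤ᵇ b) ≡ true → a ≤ b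
≤ᵇ-true⁻¹ {a} {b} = ≤ᵇ⇒≤ a b ∘ Equivalence.from T-≡

≤ᵇ-false⁻¹ : ∀ {a b} → (a ≤ᵇ b) ≡ false → b < a
≤ᵇ-false⁻¹ e = ≰⇒> λ a≤b → bool-clash (Equivalence.to T-≡ (≤⇒≤ᵇ a≤b)) e

offset : ∀ {a w} → a ≤ w → Σ[ i ∈ ℕ ] w ≡ a + i
offset {a} {w} a≤w = w ∸ a , sym (m+[n∸m]≡n a≤w)

offset-pos : ∀ {a w} → a < w → Σ[ i ∈ ℕ ] 0 < i × w ≡ a + i
offset-pos {a} {w} a<w = w ∸ a , m<n⇒0<n∸m a<w , sym (m+[n∸m]≡n (<⇒≤ a<w))

infix 4 _≺_

_≺_ : List ℕ → List ℕ → Set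
_≺_ = Lex-< _≡_ _<_

lexLt⇒≺ : ∀ x y → lexLt x y ≡ true → x ≺ y
lexLt⇒≺ []       (_ ∷ _)  _ = halt
lexLt⇒≺ (a ∷ xs) (b ∷ ys) e with <-cmp a b
... | tri< a<b _ _ = this a<b
... | tri≈ _ refl _ rewrite <ᵇ-false {a} ≤-refl | ≡ᵇ-true {a} refl = next refl (lexLt⇒≺ xs ys e)
... | tri> _ a≢b b<a rewrite <ᵇ-false (<⇒≤ b<a) | ≡ᵇ-false a≢b = contradiction e (λ ())

≺⇒lexLt : ∀ {x y} → x ≺ y → lexLt x y ≡ true
≺⇒lexLt halt = refl
≺⇒lexLt (this a<b) rewrite <ᵇ-true a<b = refl
≺⇒lexLt (next {a} refl l) rewrite <ᵇ-false {a} ≤-refl | ≡ᵇ-true {a} refl = ≺⇒lexLt l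

≺-irrefl : ∀ {x} → ¬ x ≺ x
≺-irrefl = <-irreflexive <-irrefl (≡⇒Pointwise-≡ refl)

≺-trans : ∀ {x y z} → x ≺ y → y ≺ z → x ≺ z
≺-trans = <-transitive isEquivalence <-resp₂-≡ <-trans

≺-cmp : Trichotomous _≡_ _≺_
≺-cmp x y with <-compare sym <-cmp x y
... | tri< x≺y x≉y y⊀x = tri< x≺y (x≉y ∘ ≡⇒Pointwise-≡) y⊀x
... | tri≈ x⊀y x≈y y⊀x = tri≈ x⊀y (Pointwise-≡⇒≡ x≈y) y⊀x
... | tri> x⊀y x≉y y≺x = tri> x⊀y (x≉y ∘ ≡⇒Pointwise-≡) y≺x

lexLt-irrefl : ∀ x → lexLt x x ≡ false
lexLt-irrefl x with lexLt x x in e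
... | false = refl
... | true  = ⊥-elim (≺-irrefl (lexLt⇒≺ x x e))

lcpL-cons : ∀ a xs ys → lcpL (a ∷ xs) (a ∷ ys) ≡ suc (lcpL xs ys)
lcpL-cons a xs ys rewrite ≡ᵇ-true {a} refl = refl

lcpL-cons-≢ : ∀ {a b} xs ys → a ≢ b → lcpL (a ∷ xs) (b ∷ ys) ≡ 0
lcpL-cons-≢ xs ys a≢b rewrite ≡ᵇ-false a≢b = refl

lcpL-sym : ∀ x y → lcpL x y ≡ lcpL y x
lcpL-sym []       []       = refl
lcpL-sym []       (_ ∷ _)  = refl
lcpL-sym (_ ∷ _)  []       = refl
lcpL-sym (a ∷ xs) (b ∷ ys) with a ≟ b
... | yes refl rewrite lcpL-cons a xs ys | lcpL-cons a ys xs = cong suc (lcpL-sym xs ys)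
... | no a≢b rewrite lcpL-cons-≢ xs ys a≢b | lcpL-cons-≢ ys xs (a≢b ∘ sym) = refl

lcpL-≤-length : ∀ x y → lcpL x y ≤ length x
lcpL-≤-length []       _        = z≤n
lcpL-≤-length (_ ∷ _)  []       = z≤n
lcpL-≤-length (a ∷ xs) (b ∷ ys) with a ≟ b
... | yes refl rewrite lcpL-cons a xs ys = s≤s (lcpL-≤-length xs ys)
... | no a≢b rewrite lcpL-cons-≢ xs ys a≢b = z≤n

lcpL-trans : ∀ k x y z → k ≤ lcpL x y → k ≤ lcpL y z → k ≤ lcpL x z
lcpL-trans zero    _        _        _        _  _  = z≤n
lcpL-trans (suc k) (a ∷ xs) (b ∷ ys) (c ∷ zs) h₁ h₂ with a ≟ b | b ≟ c
... | no a≢b | _ rewrite lcpL-cons-≢ xs ys a≢b = contradiction h₁ λ ()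
... | yes refl | no b≢c rewrite lcpL-cons-≢ ys zs b≢c = contradiction h₂ λ ()
... | yes refl | yes refl rewrite lcpL-cons a xs ys | lcpL-cons a ys zs | lcpL-cons a xs zs =
  s≤s (lcpL-trans k xs ys zs (s≤s⁻¹ h₁) (s≤s⁻¹ h₂))

lcpL-drop : ∀ j k x y → k + j ≤ lcpL x y → k ≤ lcpL (drop j x) (drop j y)
lcpL-drop zero    k x        y        h rewrite +-identityʳ k = h
lcpL-drop (suc j) k []       _        h = contradiction (subst (_≤ 0) (+-suc k j) h) λ ()
lcpL-drop (suc j) k (_ ∷ _)  []       h = contradiction (subst (_≤ 0) (+-suc k j) h) λ ()
lcpL-drop (suc j) k (a ∷ xs) (b ∷ ys) h with a ≟ b
... | yes refl rewrite lcpL-cons a xs ys | +-suc k j = lcpL-drop j k xs ys (s≤s⁻¹ h)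
... | no a≢b rewrite lcpL-cons-≢ xs ys a≢b | +-suc k j = contradiction h λ ()

≺-lcpL : ∀ {x y z} → x ≺ y → y ≺ z → lcpL x z ≤ lcpL x y × lcpL x z ≤ lcpL y z
≺-lcpL halt _ = z≤n , z≤n
≺-lcpL (this {xs = xs} a<b) (this {ys = zs} b<c)
  rewrite lcpL-cons-≢ xs zs (<⇒≢ (<-trans a<b b<c)) = z≤n , z≤n
≺-lcpL (this {xs = xs} a<b) (next {ys = zs} refl _)
  rewrite lcpL-cons-≢ xs zs (<⇒≢ a<b) = z≤n , z≤n
≺-lcpL (next {xs = xs} refl _) (this {ys = zs} b<c)
  rewrite lcpL-cons-≢ xs zs (<⇒≢ b<c) = z≤n , z≤n
≺-lcpL (next {a} {xs} {ys = ys} refl l₁) (next {ys = zs} refl l₂)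
  rewrite lcpL-cons a xs zs | lcpL-cons a xs ys | lcpL-cons a ys zs = Product.map s≤s s≤s (≺-lcpL l₁ l₂)

countBelow-true : ∀ k → countBelow k (λ _ → true) ≡ k
countBelow-true zero    = refl
countBelow-true (suc k) = cong suc (countBelow-true k)

module _ (P Q : ℕ → Bool) where

  countBelow-mono : ∀ k → (∀ q → q < k → P q ≡ true → Q q ≡ true) → countBelow k P ≤ countBelow k Q
  countBelow-mono zero    _   = z≤n
  countBelow-mono (suc k) P⇒Q with P k in Pk | Q k in Qk
  ... | true  | true  = s≤s (countBelow-mono k (λ q → P⇒Q q ∘ m<n⇒m<1+n))
  ... | false | true  = m≤n⇒m≤1+n (countBelow-mono k (λ q → P⇒Q q ∘ m<n⇒m<1+n))
  ... | false | false = countBelow-mono k (λ q → P⇒Q q ∘ m<n⇒m<1+n)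
  ... | true  | false = bool-clash (P⇒Q k (n<1+n k) Pk) Qk

  countBelow-mono-< : ∀ k → (∀ q → q < k → P q ≡ true → Q q ≡ true) →
                      ∀ q → q < k → P q ≡ false → Q q ≡ true → countBelow k P < countBelow k Q
  countBelow-mono-< (suc k) P⇒Q q q<1+k Pq Qq with P k in Pk | Q k in Qk | m<1+n⇒m<n∨m≡n q<1+k
  ... | true  | false | _        = bool-clash (P⇒Q k (n<1+n k) Pk) Qk
  ... | false | true  | _        = s≤s (countBelow-mono k (λ q → P⇒Q q ∘ m<n⇒m<1+n))
  ... | true  | true  | inj₁ q<k = s≤s (countBelow-mono-< k (λ q → P⇒Q q ∘ m<n⇒m<1+n) q q<k Pq Qq)
  ... | true  | true  | inj₂ refl = bool-clash Pk Pq
  ... | false | false | inj₁ q<k = countBelow-mono-< k (λ q → P⇒Q q ∘ m<n⇒m<1+n) q q<k Pq Qq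
  ... | false | false | inj₂ refl = bool-clash Qq Qk

module _ (P : ℕ → Bool) where

  false-from : ∀ {i} {R : ℕ → Set} → P i ≡ false → (∀ q → suc i ≤ q → R q → P q ≡ false) →
               ∀ q → i ≤ q → R q → P q ≡ false
  false-from Pi none q i≤q Rq with m≤n⇒m<n∨m≡n i≤q
  ... | inj₁ i<q  = none q i<q Rq
  ... | inj₂ refl = Pi

  leastFrom-spec : ∀ i f d →
    (i ≤ leastFrom i f P d × leastFrom i f P d < i + f × P (leastFrom i f P d) ≡ true ×
       (∀ q → i ≤ q → q < leastFrom i f P d → P q ≡ false))
    ⊎ (leastFrom i f P d ≡ d × (∀ q → i ≤ q → q < i + f → P q ≡ false))
  leastFrom-spec i zero d =
    inj₂ (refl , λ q i≤q q<i+0 → contradiction i≤q (<⇒≱ (subst (q <_) (+-identityʳ i) q<i+0)))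
  leastFrom-spec i (suc f) d with P i in Pi
  ... | true = inj₁ (≤-refl , m<m+n i {suc f} z<s , Pi , λ q i≤q q<i → contradiction i≤q (<⇒≱ q<i))
  ... | false with leastFrom-spec (suc i) f d
  ...   | inj₁ (i<l , l<1+i+f , Pl , below) =
          inj₁ (<⇒≤ i<l , subst (leastFrom (suc i) f P d <_) (sym (+-suc i f)) l<1+i+f , Pl , false-from Pi below)
  ...   | inj₂ (l≡d , none) = inj₂ (l≡d , false-from Pi (λ q i<q → none q i<q ∘ subst (q <_) (+-suc i f)))

  leastFromM-nothing : ∀ i f → leastFromM i f P ≡ nothing → ∀ q → i ≤ q → q < i + f → P q ≡ false
  leastFromM-nothing i zero _ q i≤q q<i+0 = contradiction i≤q (<⇒≱ (subst (q <_) (+-identityʳ i) q<i+0))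
  leastFromM-nothing i (suc f) e with P i in Pi
  ... | false = false-from Pi (λ q i<q → leastFromM-nothing (suc i) f e q i<q ∘ subst (q <_) (+-suc i f))

  leastFromM-just : ∀ i f b → leastFromM i f P ≡ just b →
    i ≤ b × b < i + f × P b ≡ true × (∀ q → i ≤ q → q < b → P q ≡ false)
  leastFromM-just i (suc f) b e with P i in Pi
  leastFromM-just i (suc f) .i refl | true =
    ≤-refl , m<m+n i z<s , Pi , λ q i≤q q<i → contradiction i≤q (<⇒≱ q<i)
  ... | false with leastFromM-just (suc i) f b e
  ...   | i<b , b<1+i+f , Pb , below = <⇒≤ i<b , subst (b <_) (sym (+-suc i f)) b<1+i+f , Pb , false-from Pi below

injective-Fin⇒hits : ∀ {m} (G : Fin (suc m) → Fin (suc m)) → (∀ x y → G x ≡ G y → x ≡ y) →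
                     ∀ i → ¬ (∀ x → i ≢ G x)
injective-Fin⇒hits G G-inj i misses
  with x , y , x<y , e ← pigeonhole (n<1+n _) (λ x → punchOut (misses x)) =
  <-irrefl (cong toℕ (G-inj x y (punchOut-injective (misses x) (misses y) e))) x<y

injective⇒hits : ∀ n (F : ℕ → ℕ) → (∀ x → x < n → F x < n) →
                 (∀ x y → x < n → y < n → F x ≡ F y → x ≡ y) →
                 ∀ i → i < n → ¬ (∀ x → x < n → F x ≢ i)
injective⇒hits (suc m) F F< F-inj i i<n misses =
  injective-Fin⇒hits G G-inj (fromℕ< i<n) (λ x e → misses (toℕ x) (toℕ<n x) (toℕ-G≡ e))
  where
  G : Fin (suc m) → Fin (suc m)
  G x = fromℕ< (F< (toℕ x) (toℕ<n x))
  toℕ-G : ∀ x → toℕ (G x) ≡ F (toℕ x)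
  toℕ-G x = toℕ-fromℕ< (F< (toℕ x) (toℕ<n x))
  G-inj : ∀ x y → G x ≡ G y → x ≡ y
  G-inj x y e = toℕ-injective (F-inj (toℕ x) (toℕ y) (toℕ<n x) (toℕ<n y)
                  (trans (sym (toℕ-G x)) (trans (cong toℕ e) (toℕ-G y))))
  toℕ-G≡ : ∀ {x} → fromℕ< i<n ≡ G x → F (toℕ x) ≡ i
  toℕ-G≡ {x} e = trans (sym (toℕ-G x)) (trans (sym (cong toℕ e)) (toℕ-fromℕ< i<n))

module SuffixArray (s : List ℕ) where

  n : ℕ
  n = length s

  suf-injective : ∀ {a b} → a < n → b < n → suf s a ≡ suf s b → a ≡ b
  suf-injective {a} {b} a<n b<n e = ∸-cancelˡ-≡ (<⇒≤ a<n) (<⇒≤ b<n)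
    (trans (sym (length-drop a s)) (trans (cong length e) (length-drop b s)))

  ISA-< : ∀ {p} → p < n → ISA s p < n
  ISA-< {p} p<n = subst (ISA s p <_) (countBelow-true n)
    (countBelow-mono-< _ _ n (λ _ _ _ → refl) p p<n (lexLt-irrefl (suf s p)) refl)

  ISA-mono : ∀ {a b} → a < n → suf s a ≺ suf s b → ISA s a < ISA s b
  ISA-mono {a} {b} a<n a≺b = countBelow-mono-< _ _ n
    (λ q _ q≺a → ≺⇒lexLt (≺-trans (lexLt⇒≺ (suf s q) (suf s a) q≺a) a≺b))
    a a<n (lexLt-irrefl (suf s a)) (≺⇒lexLt a≺b)

  suf-≺-connex : ∀ {a b} → a < n → b < n → a ≢ b → suf s a ≺ suf s b ⊎ suf s b ≺ suf s a
  suf-≺-connex {a} {b} a<n b<n a≢b with ≺-cmp (suf s a) (suf s b)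
  ... | tri< a≺b _ _ = inj₁ a≺b
  ... | tri≈ _ e _   = contradiction (suf-injective a<n b<n e) a≢b
  ... | tri> _ _ b≺a = inj₂ b≺a

  ISA-injective : ∀ {a b} → a < n → b < n → ISA s a ≡ ISA s b → a ≡ b
  ISA-injective {a} {b} a<n b<n e with a ≟ b
  ... | yes a≡b = a≡b
  ... | no a≢b with suf-≺-connex a<n b<n a≢b
  ...   | inj₁ a≺b = contradiction e (<⇒≢ (ISA-mono {b = b} a<n a≺b))
  ...   | inj₂ b≺a = contradiction (sym e) (<⇒≢ (ISA-mono {b = a} b<n b≺a))

  ISA-<⇒≺ : ∀ {a b} → a < n → b < n → ISA s a < ISA s b → suf s a ≺ suf s b
  ISA-<⇒≺ {a} {b} a<n b<n ISAa<ISAb with a ≟ b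
  ... | yes refl = contradiction ISAa<ISAb (<-irrefl refl)
  ... | no a≢b with suf-≺-connex a<n b<n a≢b
  ...   | inj₁ a≺b = a≺b
  ...   | inj₂ b≺a = contradiction ISAa<ISAb (<-asym (ISA-mono {b = a} b<n b≺a))

  -- For n = 0 the search defining SA returns its default 0, which is no position.
  SA-< : 1 ≤ n → ∀ i → SA s i < n
  SA-< 1≤n i with leastFrom-spec (λ p → ISA s p ≡ᵇ i) 0 n 0
  ... | inj₁ (_ , SAi<n , _) = SAi<n
  ... | inj₂ (SAi≡0 , _)     = subst (_< n) (sym SAi≡0) 1≤n

  ISA-SA : ∀ {i} → i < n → ISA s (SA s i) ≡ i
  ISA-SA {i} i<n with leastFrom-spec (λ p → ISA s p ≡ᵇ i) 0 n 0
  ... | inj₁ (_ , _ , found , _) = ≡ᵇ-true⁻¹ found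
  ... | inj₂ (_ , none) = contradiction
          (λ x x<n ISAx≡i → bool-clash (≡ᵇ-true ISAx≡i) (none x z≤n x<n))
          (injective⇒hits n (ISA s) (λ _ → ISA-<) (λ _ _ → ISA-injective) i i<n)

  lcp-≤-between-left : ∀ {t a p} → t < n → a < n → p < n → ISA s t ≤ ISA s a → ISA s a < ISA s p →
                  lcp s t p ≤ lcp s a p
  lcp-≤-between-left {t} {a} {p} t<n a<n p<n t≤a a<p with m≤n⇒m<n∨m≡n t≤a
  ... | inj₂ t≡a rewrite ISA-injective t<n a<n t≡a = ≤-refl
  ... | inj₁ t<a = proj₂ (≺-lcpL (ISA-<⇒≺ t<n a<n t<a) (ISA-<⇒≺ a<n p<n a<p))

  lcp-≤-between-right : ∀ {t b p} → t < n → b < n → p < n → ISA s p < ISA s b → ISA s b ≤ ISA s t →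
                   lcp s t p ≤ lcp s b p
  lcp-≤-between-right {t} {b} {p} t<n b<n p<n p<b b≤t with m≤n⇒m<n∨m≡n b≤t
  ... | inj₂ b≡t rewrite ISA-injective b<n t<n b≡t = ≤-refl
  ... | inj₁ b<t = subst₂ _≤_ (lcpL-sym (suf s p) (suf s t)) (lcpL-sym (suf s p) (suf s b))
      (proj₁ (≺-lcpL (ISA-<⇒≺ p<n b<n p<b) (ISA-<⇒≺ b<n t<n b<t)))

module Irreducible (s : List ℕ) where
  open SuffixArray s

  Rle-≤ : ∀ i → Rle s i ≤ i
  Rle-≤ zero = z≤n
  Rle-≤ (suc i) with irrIdx s (suc i)
  ... | true  = ≤-refl
  ... | false = m≤n⇒m≤1+n (Rle-≤ i)

  Rle-irreducible : ∀ i → irrIdx s (Rle s i) ≡ true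
  Rle-irreducible zero = refl
  Rle-irreducible (suc i) with irrIdx s (suc i) in e
  ... | true  = e
  ... | false = Rle-irreducible i

  Rle-maximal : ∀ i j → j ≤ i → irrIdx s j ≡ true → j ≤ Rle s i
  Rle-maximal zero    j j≤0   _  = j≤0
  Rle-maximal (suc i) j j≤1+i ej with irrIdx s (suc i) in e | m≤n⇒m<n∨m≡n j≤1+i
  ... | true  | _        = j≤1+i
  ... | false | inj₁ j<1+i = Rle-maximal i j (s≤s⁻¹ j<1+i) ej
  ... | false | inj₂ refl  = bool-clash ej e

  Rge-just : ∀ i b → i ≤ n → Rge s i ≡ just b → i ≤ b × b < n × irrIdx s b ≡ true
  Rge-just i b i≤n e with leastFromM-just (irrIdx s) i (n ∸ i) b e
  ... | i≤b , b<i+[n∸i] , eb , _ = i≤b , subst (b <_) (m+[n∸m]≡n i≤n) b<i+[n∸i] , eb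

  Rge-minimal : ∀ i j → i ≤ j → j < n → irrIdx s j ≡ true → ∃ λ b → Rge s i ≡ just b × b ≤ j
  Rge-minimal i j i≤j j<n ej with Rge s i in e
  ... | nothing = bool-clash ej (leastFromM-nothing (irrIdx s) i (n ∸ i) e j i≤j
                    (subst (j <_) (sym (m+[n∸m]≡n (≤-trans i≤j (<⇒≤ j<n)))) j<n))
  ... | just b with leastFromM-just (irrIdx s) i (n ∸ i) b e | b ≤? j
  ...   | _ , _ , _ , _     | yes b≤j = b , refl , b≤j
  ...   | _ , _ , _ , below | no b≰j  = bool-clash ej (below j i≤j (≰⇒> b≰j))

  irrIdx⇒irrPos : ∀ {i} → i < n → irrIdx s i ≡ true → irrPos s (SA s i) ≡ true
  irrIdx⇒irrPos i<n e = trans (cong (irrIdx s) (ISA-SA i<n)) e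

  closest-≥-Rle : ∀ p → lcp s (SA s (Rle s (ISA s p))) p ≤ lcp s (closest s p) p
  closest-≥-Rle p with Rge s (ISA s p)
  ... | nothing = ≤-refl
  ... | just b with lcp s (SA s b) p ≤ᵇ lcp s (SA s (Rle s (ISA s p))) p in e
  ...   | true  = ≤-refl
  ...   | false = <⇒≤ (≤ᵇ-false⁻¹ e)

  closest-≥-Rge : ∀ p b → Rge s (ISA s p) ≡ just b → lcp s (SA s b) p ≤ lcp s (closest s p) p
  closest-≥-Rge p b e with Rge s (ISA s p)
  closest-≥-Rge p b refl | just .b with lcp s (SA s b) p ≤ᵇ lcp s (SA s (Rle s (ISA s p))) p in e
  ... | true  = ≤ᵇ-true⁻¹ e
  ... | false = ≤-refl

  SA-Rle-irreducible : ∀ {p} → p < n → SA s (Rle s (ISA s p)) < n × irrPos s (SA s (Rle s (ISA s p))) ≡ true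
  SA-Rle-irreducible {p} p<n = SA-< (≤-<-trans z≤n p<n) _ ,
    irrIdx⇒irrPos (≤-<-trans (Rle-≤ (ISA s p)) (ISA-< p<n)) (Rle-irreducible (ISA s p))

  closest-irreducible : ∀ p → p < n → closest s p < n × irrPos s (closest s p) ≡ true
  closest-irreducible p p<n with Rge s (ISA s p) in e
  ... | nothing = SA-Rle-irreducible p<n
  ... | just b with lcp s (SA s b) p ≤ᵇ lcp s (SA s (Rle s (ISA s p))) p
  ...   | true  = SA-Rle-irreducible p<n
  ...   | false with Rge-just (ISA s p) b (<⇒≤ (ISA-< p<n)) e
  ...     | _ , b<n , eb = SA-< (≤-<-trans z≤n p<n) b , irrIdx⇒irrPos b<n eb

  -- An irreducible t lies on one side of p in SA; the nearest irreducible index on that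
  -- side (R≤ or R≥) lies between t and p in SA, so its suffix shares at least lcp(t, p) with p.
  closest-maximal : ∀ p t → p < n → irrPos s p ≡ false → t < n → irrPos s t ≡ true →
                    lcp s t p ≤ lcp s (closest s p) p
  closest-maximal p t p<n ep t<n et with <-cmp (ISA s t) (ISA s p)
  ... | tri≈ _ ISAt≡ISAp _ = contradiction ISAt≡ISAp (Bool-separates (irrIdx s) et ep)
  ... | tri< t<p _ _ = ≤-trans
          (lcp-≤-between-left t<n (SA-< 1≤n a) p<n (subst (ISA s t ≤_) (sym (ISA-SA a<n)) t≤a)
                                              (subst (_< ISA s p) (sym (ISA-SA a<n)) a<p))
          (closest-≥-Rle p)
    where
    1≤n = ≤-<-trans z≤n p<n
    a = Rle s (ISA s p)
    a<n = ≤-<-trans (Rle-≤ (ISA s p)) (ISA-< p<n)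
    t≤a = Rle-maximal (ISA s p) (ISA s t) (<⇒≤ t<p) et
    a<p = ≤∧≢⇒< (Rle-≤ (ISA s p)) (Bool-separates (irrIdx s) (Rle-irreducible (ISA s p)) ep)
  ... | tri> _ _ p<t with Rge-minimal (ISA s p) (ISA s t) (<⇒≤ p<t) (ISA-< t<n) et
  ...   | b , e , b≤t with Rge-just (ISA s p) b (<⇒≤ (ISA-< p<n)) e
  ...     | p≤b , b<n , eb = ≤-trans
            (lcp-≤-between-right t<n (SA-< (≤-<-trans z≤n p<n) b) p<n (subst (ISA s p <_) (sym (ISA-SA b<n)) p<b)
                                                              (subst (_≤ ISA s t) (sym (ISA-SA b<n)) b≤t))
            (closest-≥-Rge p b e)
    where
    p<b = ≤∧≢⇒< p≤b (Bool-separates (irrIdx s) eb ep ∘ sym)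

  lcp-pos⇒< : ∀ t q → 0 < lcp s t q → t < n
  lcp-pos⇒< t q 0<lcp = m∸n≢0⇒n<m λ n∸t≡0 → <⇒≱ 0<lcp
    (subst (lcp s t q ≤_) (trans (length-drop t s) n∸t≡0) (lcpL-≤-length (suf s t) (suf s q)))

  cval-reducible : ∀ q → irrPos s q ≡ false → cval s q ≡ lcp s (closest s q) q
  cval-reducible q e rewrite e = refl

  lcp-≤-cval : ∀ q t → q < n → irrPos s q ≡ false → t < n → irrPos s t ≡ true → lcp s t q ≤ cval s q
  lcp-≤-cval q t q<n eq t<n et rewrite cval-reducible q eq = closest-maximal q t q<n eq t<n et

  -- The closest irreducible neighbour of q′ also shares k letters with q.
  cval-lower-bound : ∀ {k q q′} → q < n → irrPos s q ≡ false → q′ < n → irrPos s q′ ≡ false →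
                     k ≤ cval s q′ → k ≤ lcp s q′ q → k ≤ cval s q
  cval-lower-bound {k} {q} {q′} q<n eq q′<n eq′ k≤cq′ k≤lcp = ≤-trans
    (lcpL-trans k (suf s t) (suf s q′) (suf s q) (subst (k ≤_) (cval-reducible q′ eq′) k≤cq′) k≤lcp)
    (lcp-≤-cval q t q<n eq (proj₁ t-irr) (proj₂ t-irr))
    where
    t = closest s q′
    t-irr = closest-irreducible q′ q′<n

  cval-transfer : ∀ {q q′} → q < n → irrPos s q ≡ false → cval s q < lcp s q q′ →
                  q′ < n × irrPos s q′ ≡ false × cval s q′ ≡ cval s q
  cval-transfer {q} {q′} q<n eq cq<lcp = q′<n , eq′ , ≤-antisym cq′≤cq cq≤cq′
    where
    cq<lcp′ : cval s q < lcp s q′ q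
    cq<lcp′ = subst (cval s q <_) (lcpL-sym (suf s q) (suf s q′)) cq<lcp
    q′<n = lcp-pos⇒< q′ q (≤-<-trans z≤n cq<lcp′)
    eq′ : irrPos s q′ ≡ false
    eq′ with irrPos s q′ in e
    ... | false = refl
    ... | true  = contradiction (lcp-≤-cval q q′ q<n eq q′<n e) (<⇒≱ cq<lcp′)
    cq≤cq′ = cval-lower-bound q′<n eq′ q<n eq ≤-refl (<⇒≤ cq<lcp)
    cq′≤cq = ≮⇒≥ λ cq<cq′ → <-irrefl refl (cval-lower-bound q<n eq q′<n eq′ cq<cq′ cq<lcp′)

  nextIrr-spec : ∀ b → b < n →
    (b < nextIrr s b × nextIrr s b < n × irrPos s (nextIrr s b) ≡ true ×
       (∀ q → b < q → q < nextIrr s b → irrPos s q ≡ false))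
    ⊎ (nextIrr s b ≡ n × (∀ q → b < q → q < n → irrPos s q ≡ false))
  nextIrr-spec b b<n with leastFrom-spec (irrPos s) (suc b) (n ∸ suc b) n
  ... | inj₁ (b<e , e<n , ee , below) = inj₁ (b<e , subst (nextIrr s b <_) (m+[n∸m]≡n b<n) e<n , ee , below)
  ... | inj₂ (e≡n , none) = inj₂ (e≡n , λ q b<q q<n → none q b<q (subst (q <_) (sym (m+[n∸m]≡n b<n)) q<n))

  nextIrr-inside : ∀ b v → b < n → b < v → v < nextIrr s b → v < n × irrPos s v ≡ false
  nextIrr-inside b v b<n b<v v<e with nextIrr-spec b b<n
  ... | inj₁ (_ , e<n , _ , below) = <-trans v<e e<n , below v b<v v<e
  ... | inj₂ (e≡n , none) = v<n , none v b<v v<n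
    where v<n = subst (v <_) e≡n v<e

  <nextIrr : ∀ b v → b < n → (∀ w → b < w → w ≤ v → w < n × irrPos s w ≡ false) → v < nextIrr s b
  <nextIrr b v b<n inside with nextIrr-spec b b<n | nextIrr s b ≤? v
  ... | inj₁ _ | no e≰v = ≰⇒> e≰v
  ... | inj₁ (b<e , _ , ee , _) | yes e≤v =
    contradiction refl (Bool-separates (irrPos s) {nextIrr s b} ee (proj₂ (inside _ b<e e≤v)))
  ... | inj₂ (e≡n , _) | _ = subst (v <_) (sym e≡n) v<n
    where
    v<n : v < n
    v<n with v ≤? b
    ... | yes v≤b = ≤-<-trans v≤b b<n
    ... | no v≰b  = proj₁ (inside v (≰⇒> v≰b) ≤-refl)

  -- The block of b ends at n or at an irreducible position.
  nextIrr-unreached : ∀ b v → b < n → v ≤ nextIrr s b → v < n → irrPos s v ≡ false → v < nextIrr s b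
  nextIrr-unreached b v b<n v≤e v<n ev with m≤n⇒m<n∨m≡n v≤e | nextIrr-spec b b<n
  ... | inj₁ v<e | _ = v<e
  ... | inj₂ refl | inj₁ (_ , _ , ee , _) = contradiction refl (Bool-separates (irrPos s) {nextIrr s b} ee ev)
  ... | inj₂ refl | inj₂ (e≡n , _) = contradiction e≡n (<⇒≢ v<n)

gtW-trans : ∀ x y z → gtW x y ≡ true → gtW y z ≡ true → gtW x z ≡ true
gtW-trans ∞       _       (fin _) _   _   = refl
gtW-trans ∞       ∞       ∞       ()  _
gtW-trans ∞       (fin _) ∞       _   ()
gtW-trans (fin a) (fin b) (fin c) a>b b>c =
  <ᵇ-true {c} {a} (<-trans (<ᵇ-true⁻¹ {c} {b} b>c) (<ᵇ-true⁻¹ {b} {a} a>b))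

gtW-irrefl : ∀ x → gtW x x ≡ false
gtW-irrefl ∞       = refl
gtW-irrefl (fin a) = <ᵇ-false {a} ≤-refl

gtW-asym : ∀ x y → gtW x y ≡ true → gtW y x ≡ false
gtW-asym ∞       (fin _) _   = refl
gtW-asym (fin a) (fin b) a>b = <ᵇ-false {a} {b} (<⇒≤ (<ᵇ-true⁻¹ {b} a>b))

gtW-≯⇒≥W : ∀ {a c} w → gtW (fin a) w ≡ false → c ≤ a → w ≥W c
gtW-≯⇒≥W ∞       _   _   = _
gtW-≯⇒≥W {a} (fin b) a≯b c≤a = ≤-trans c≤a (<ᵇ-false⁻¹ {b} {a} a≯b)

gtW-trans-≯ : ∀ x y z → gtW x z ≡ true → gtW y z ≡ false → gtW x y ≡ true
gtW-trans-≯ ∞       (fin _) _       _   _   = refl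
gtW-trans-≯ ∞       ∞       (fin _) _   ()
gtW-trans-≯ (fin a) (fin b) (fin c) a>c b≯c =
  <ᵇ-true {b} {a} (≤-<-trans (<ᵇ-false⁻¹ {c} {b} b≯c) (<ᵇ-true⁻¹ {c} {a} a>c))

-- The local search `go` of parentI is not in scope here; this metavariable is solved
-- by unification with it, so that it can be reasoned about by induction on the fuel.
mutual
  parentGo : List ℕ → ℕ → ℕ → ℕ → ℕ
  parentGo = λ s b q → _

  parentI≡parentGo : ∀ s b q → parentI s b q ≡ parentGo s b q (q ∸ b)
  parentI≡parentGo s b q with q ∸ b
  ... | k = refl

module ITree (s : List ℕ) (b : ℕ) where

  infix 4 _>ʷ_

  _>ʷ_ : ℕ → ℕ → Bool
  t >ʷ q = gtW (wt s b t) (wt s b q)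

  wt-root : wt s b b ≡ ∞
  wt-root rewrite ≡ᵇ-true {b} refl = refl

  wt-nonroot : ∀ t → t ≢ b → wt s b t ≡ fin (t ∸ b + cval s t)
  wt-nonroot t t≢b rewrite ≡ᵇ-false t≢b = refl

  root->ʷ : ∀ q → q ≢ b → (b >ʷ q) ≡ true
  root->ʷ q q≢b rewrite wt-root | wt-nonroot q q≢b = refl

  ≯-extend : ∀ {q k} {L : ℕ → Set} → ((b + k) >ʷ q) ≡ false →
             (∀ v → L v → v < b + k → (v >ʷ q) ≡ false) →
             ∀ v → L v → v < b + suc k → (v >ʷ q) ≡ false
  ≯-extend {q} {k} e none v Lv v<b+1+k with m≤n⇒m<n∨m≡n (s≤s⁻¹ (subst (v <_) (+-suc b k) v<b+1+k))
  ... | inj₁ v<b+k = none v Lv v<b+k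
  ... | inj₂ refl  = e

  parentGo-spec : ∀ q k →
      (parentGo s b q k ≡ b × (∀ v → b ≤ v → v < b + k → (v >ʷ q) ≡ false))
    ⊎ (b ≤ parentGo s b q k × parentGo s b q k < b + k × (parentGo s b q k >ʷ q) ≡ true ×
       (∀ v → parentGo s b q k < v → v < b + k → (v >ʷ q) ≡ false))
  parentGo-spec q zero =
    inj₁ (refl , λ v b≤v v<b+0 → contradiction b≤v (<⇒≱ (subst (v <_) (+-identityʳ b) v<b+0)))
  parentGo-spec q (suc k) with (b + k) >ʷ q in e
  ... | true = inj₂ (m≤m+n b k , +-monoʳ-< b (n<1+n k) , e ,
                     λ v b+k<v v<b+1+k → contradiction (s≤s⁻¹ (subst (v <_) (+-suc b k) v<b+1+k)) (<⇒≱ b+k<v))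
  ... | false with parentGo-spec q k
  ...   | inj₁ (P≡b , none) = inj₁ (P≡b , ≯-extend e none)
  ...   | inj₂ (b≤P , P<b+k , P>q , none) =
          inj₂ (b≤P , <-trans P<b+k (+-monoʳ-< b (n<1+n k)) , P>q , ≯-extend e none)

  record IsParent (P q : ℕ) : Set where
    field
      root≤ : b ≤ P
      <child : P < q
      heavier : (P >ʷ q) ≡ true
      lighter-between : ∀ v → P < v → v < q → (v >ʷ q) ≡ false

  parent-isParent : ∀ q → b < q → IsParent (parentI s b q) q
  parent-isParent q b<q rewrite parentI≡parentGo s b q with parentGo-spec q (q ∸ b)
  ... | inj₁ (_ , none) = bool-clash (root->ʷ q (<⇒≢ b<q ∘ sym)) (none b ≤-refl b<b+[q∸b])
    where b<b+[q∸b] = subst (b <_) (sym (m+[n∸m]≡n (<⇒≤ b<q))) b<q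
  ... | inj₂ (b≤P , P<b+[q∸b] , P>q , none) = record
    { root≤ = b≤P
    ; <child = subst (parentGo s b q (q ∸ b) <_) b+[q∸b]≡q P<b+[q∸b]
    ; heavier = P>q
    ; lighter-between = λ v P<v v<q → none v P<v (subst (v <_) (sym b+[q∸b]≡q) v<q)
    }
    where b+[q∸b]≡q = m+[n∸m]≡n (<⇒≤ b<q)

  isParent-unique : ∀ {P Q q} → IsParent P q → IsParent Q q → P ≡ Q
  isParent-unique {P} {Q} isP isQ with <-cmp P Q
  ... | tri≈ _ P≡Q _ = P≡Q
  ... | tri< P<Q _ _ = bool-clash (IsParent.heavier isQ)
                                   (IsParent.lighter-between isP Q P<Q (IsParent.<child isQ))
  ... | tri> _ _ Q<P = bool-clash (IsParent.heavier isP)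
                                   (IsParent.lighter-between isQ P Q<P (IsParent.<child isP))

  Dominates : ℕ → ℕ → Set
  Dominates x v = x ≤ v × (∀ t → x < t → t ≤ v → (x >ʷ t) ≡ true)

  desc⇒dominates : ∀ {x v} → Desc (I s b) x v → Dominates x v
  desc⇒dominates here = ≤-refl , λ t x<t t≤x → contradiction t≤x (<⇒≱ x<t)
  desc⇒dominates {x} {v} (step v∈I v≢b x↝P) = ≤-trans x≤P (<⇒≤ P<v) , dominated
    where
    open IsParent (parent-isParent v (≤∧≢⇒< (proj₁ v∈I) (v≢b ∘ sym)))
      renaming (<child to P<v; heavier to P>v)
    P = parentI s b v
    x≤P = proj₁ (desc⇒dominates x↝P)
    x>ʷ = proj₂ (desc⇒dominates x↝P)
    x>v : (x >ʷ v) ≡ true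
    x>v with m≤n⇒m<n∨m≡n x≤P
    ... | inj₂ refl = P>v
    ... | inj₁ x<P  = gtW-trans (wt s b x) (wt s b P) (wt s b v) (x>ʷ P x<P ≤-refl) P>v
    dominated : ∀ t → x < t → t ≤ v → (x >ʷ t) ≡ true
    dominated t x<t t≤v with t ≤? P | m≤n⇒m<n∨m≡n t≤v
    ... | yes t≤P | _         = x>ʷ t x<t t≤P
    ... | no t≰P  | inj₁ t<v  =
      gtW-trans-≯ (wt s b x) (wt s b t) (wt s b v) x>v (lighter-between t (≰⇒> t≰P) t<v)
    ... | no _    | inj₂ refl = x>v

  ≤-parent : ∀ x v → b < v → x < v → (x >ʷ v) ≡ true → x ≤ parentI s b v
  ≤-parent x v b<v x<v x>v with x ≤? parentI s b v
  ... | yes x≤P = x≤P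
  ... | no x≰P  = bool-clash x>v (IsParent.lighter-between (parent-isParent v b<v) x (≰⇒> x≰P) x<v)

  dominates⇒desc : ∀ {x v} → b ≤ x → Node (I s b) v → Dominates x v → Desc (I s b) x v
  dominates⇒desc {x} b≤x = go (<-wellFounded _)
    where
    go : ∀ {v} → Acc _<_ v → Node (I s b) v → Dominates x v → Desc (I s b) x v
    go {v} (acc rec) v∈I (x≤v , x>ʷ) with v ≟ x
    ... | yes refl = here
    ... | no v≢x =
      step v∈I (<⇒≢ b<v ∘ sym) (go (rec P<v) (root≤ , <-trans P<v (proj₂ v∈I)) (x≤P , x>ʷ′))
      where
      x<v = ≤∧≢⇒< x≤v (v≢x ∘ sym)
      b<v = ≤-<-trans b≤x x<v
      open IsParent (parent-isParent v b<v) renaming (<child to P<v)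
      x≤P = ≤-parent x v b<v x<v (x>ʷ v x<v ≤-refl)
      x>ʷ′ : ∀ t → x < t → t ≤ parentI s b v → (x >ʷ t) ≡ true
      x>ʷ′ t x<t t≤P = x>ʷ t x<t (≤-trans t≤P (<⇒≤ P<v))

  rootChild-ancestor : ∀ {v} → Node (I s b) v → b < v →
                       Σ[ y ∈ ℕ ] Node (I s b) y × b < y × parentI s b y ≡ b × Desc (I s b) y v
  rootChild-ancestor = go (<-wellFounded _)
    where
    go : ∀ {v} → Acc _<_ v → Node (I s b) v → b < v →
         Σ[ y ∈ ℕ ] Node (I s b) y × b < y × parentI s b y ≡ b × Desc (I s b) y v
    go {v} (acc rec) v∈I b<v with parentI s b v ≟ b
    ... | yes P≡b = v , v∈I , b<v , P≡b , here
    ... | no P≢b with go (rec P<v) (root≤ , <-trans P<v (proj₂ v∈I)) (≤∧≢⇒< root≤ (P≢b ∘ sym))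
      where open IsParent (parent-isParent v b<v) renaming (<child to P<v)
    ...   | y , y∈I , b<y , Py≡b , y↝P = y , y∈I , b<y , Py≡b , step v∈I (<⇒≢ b<v ∘ sym) y↝P

  rootChild-not-lighter : ∀ {y v} → b < y → parentI s b y ≡ b → Desc (I s b) y v →
                          ∀ t → b < t → t ≤ v → (t >ʷ y) ≡ false
  rootChild-not-lighter {y} b<y Py≡b y↝v t b<t t≤v with <-cmp t y
  ... | tri< t<y _ _ = IsParent.lighter-between (parent-isParent y b<y) t (subst (_< t) (sym Py≡b) b<t) t<y
  ... | tri≈ _ refl _ = gtW-irrefl (wt s b t)
  ... | tri> _ _ y<t = gtW-asym (wt s b y) (wt s b t) (proj₂ (desc⇒dominates y↝v) t y<t t≤v)

module SubtreeIso (s : List ℕ) (p′ : ℕ) (p′<n : p′ < length s) (p : ℕ) (p′<p : p′ < p)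
                  (p∈I : Node (I s p′) p) (p-reducible : irrPos s p ≡ false) where
  open SuffixArray s
  open Irreducible s

  r c d e e′ : ℕ
  r = closest s p
  c = lcp s r p
  d = p ∸ p′
  e = nextIrr s p′
  e′ = nextIrr s r

  module T = ITree s p′
  module U = ITree s r

  p<n : p < n
  p<n = proj₁ (nextIrr-inside p′ p p′<n p′<p (proj₂ p∈I))

  r<n : r < n
  r<n = proj₁ (closest-irreducible p p<n)

  cval-p : cval s p ≡ c
  cval-p = cval-reducible p p-reducible

  lcp-shifted : ∀ j x → j + x < c → x < lcp s (p + j) (r + j)
  lcp-shifted j x j+x<c = subst₂ (λ u v → x < lcpL u v) (drop-drop p j s) (drop-drop r j s)
    (lcpL-drop j (suc x) (suf s p) (suf s r)
      (subst₂ _≤_ (cong suc (+-comm j x)) (lcpL-sym (suf s r) (suf s p)) j+x<c))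

  -- The offsets j of the nodes q + j below p (q = p) and of the unpruned nodes of I_r (q = r):
  -- every step q + i on the way weighs less than c relative to q.
  Light : ℕ → ℕ → Set
  Light q j = ∀ i → 0 < i → i ≤ j → i + cval s (q + i) < c

  Agree : ℕ → Set
  Agree j = ∀ i → 0 < i → i ≤ j → r + i < n × irrPos s (r + i) ≡ false × cval s (r + i) ≡ cval s (p + i)

  agree-light : ∀ {j} → Agree j → Light p j → Light r j
  agree-light agree light i 0<i i≤j rewrite proj₂ (proj₂ (agree i 0<i i≤j)) = light i 0<i i≤j

  shift-to-r : ∀ j → p + j < e → Light p j → Agree j
  shift-to-r j p+j<e light i 0<i i≤j =
    cval-transfer (proj₁ p+i-inside) (proj₂ p+i-inside) (lcp-shifted i _ (light i 0<i i≤j))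
    where
    p+i-inside =
      nextIrr-inside p′ (p + i) p′<n (<-≤-trans p′<p (m≤m+n p i)) (≤-<-trans (+-monoʳ-≤ p i≤j) p+j<e)

  r+i-inside : ∀ {j} → r + j < e′ → ∀ i → 0 < i → i ≤ j → r + i < n × irrPos s (r + i) ≡ false
  r+i-inside r+j<e′ i 0<i i≤j =
    nextIrr-inside r (r + i) r<n (m<m+n r 0<i) (≤-<-trans (+-monoʳ-≤ r i≤j) r+j<e′)

  shift-to-p : ∀ j → r + j < e′ → Light r j → p + j < e × Agree j
  shift-to-p j r+j<e′ light = p+i<e j ≤-refl , agree
    where
    transfer : ∀ i → 0 < i → i ≤ j → p + i < n × irrPos s (p + i) ≡ false × cval s (p + i) ≡ cval s (r + i)
    transfer i 0<i i≤j = cval-transfer (proj₁ inside) (proj₂ inside)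
      (subst (cval s (r + i) <_) (lcpL-sym (suf s (p + i)) (suf s (r + i))) (lcp-shifted i _ (light i 0<i i≤j)))
      where inside = r+i-inside r+j<e′ i 0<i i≤j
    p+i<e : ∀ i → i ≤ j → p + i < e
    p+i<e zero _ = subst (_< e) (sym (+-identityʳ p)) (proj₂ p∈I)
    p+i<e (suc i) 1+i≤j with transfer (suc i) z<s 1+i≤j
    ... | p+1+i<n , reducible , _ = nextIrr-unreached p′ (p + suc i) p′<n
            (subst (_≤ e) (sym (+-suc p i)) (p+i<e i (<⇒≤ 1+i≤j))) p+1+i<n reducible
    agree : Agree j
    agree i 0<i i≤j = proj₁ inside , proj₂ inside , sym (proj₂ (proj₂ (transfer i 0<i i≤j)))
      where inside = r+i-inside r+j<e′ i 0<i i≤j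

  p′≤p : p′ ≤ p
  p′≤p = <⇒≤ p′<p

  wt-T : ∀ a → wt s p′ (p + a) ≡ fin (d + (a + cval s (p + a)))
  wt-T a rewrite T.wt-nonroot (p + a) (<⇒≢ (<-≤-trans p′<p (m≤m+n p a)) ∘ sym) | +-∸-comm a p′≤p =
    cong fin (+-assoc d a (cval s (p + a)))

  wt-T-p : wt s p′ p ≡ fin (d + c)
  wt-T-p rewrite T.wt-nonroot p (<⇒≢ p′<p ∘ sym) = cong (λ x → fin (d + x)) cval-p

  wt-U : ∀ a → 0 < a → wt s r (r + a) ≡ fin (a + cval s (r + a))
  wt-U a 0<a rewrite U.wt-nonroot (r + a) (<⇒≢ (m<m+n r 0<a) ∘ sym) | m+n∸m≡n r a = refl

  >ʷ-T : ∀ a b → (p + a T.>ʷ p + b) ≡ (b + cval s (p + b) <ᵇ a + cval s (p + a))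
  >ʷ-T a b rewrite wt-T a | wt-T b = <ᵇ-+-cancelˡ d _ _

  >ʷ-T-p : ∀ b → (p T.>ʷ p + b) ≡ (b + cval s (p + b) <ᵇ c)
  >ʷ-T-p b rewrite wt-T-p | wt-T b = <ᵇ-+-cancelˡ d _ _

  >ʷ-U : ∀ a b → 0 < a → 0 < b → (r + a U.>ʷ r + b) ≡ (b + cval s (r + b) <ᵇ a + cval s (r + a))
  >ʷ-U a b 0<a 0<b rewrite wt-U a 0<a | wt-U b 0<b = refl

  subtree⇒light : ∀ {v} → Desc (I s p′) p v → Σ[ j ∈ ℕ ] v ≡ p + j × Light p j
  subtree⇒light p↝v with p≤v , p>ʷ ← T.desc⇒dominates p↝v with j , refl ← offset p≤v = j , refl , light
    where
    light : Light p j
    light i 0<i i≤j = <ᵇ-true⁻¹ (trans (sym (>ʷ-T-p i)) (p>ʷ (p + i) (m<m+n p 0<i) (+-monoʳ-≤ p i≤j)))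

  light⇒subtree : ∀ j → p + j < e → Light p j → Desc (I s p′) p (p + j)
  light⇒subtree j p+j<e light =
    T.dominates⇒desc p′≤p (≤-trans p′≤p (m≤m+n p j) , p+j<e) (m≤m+n p j , dominated)
    where
    dominated : ∀ t → p < t → t ≤ p + j → (p T.>ʷ t) ≡ true
    dominated t p<t t≤p+j with i , 0<i , refl ← offset-pos p<t =
      trans (>ʷ-T-p i) (<ᵇ-true (light i 0<i (+-cancelˡ-≤ p i j t≤p+j)))

  Kept : ℕ → Set
  Kept v = ∀ y → Node (I s r) y → y ≢ r → parentI s r y ≡ r → wt s r y ≥W c → ¬ Desc (I s r) y v

  -- A heavy position r + i on the way to v forces the root child above v to be heavy too.
  pruned⇒light : ∀ {v} → Node (I s r) v → Kept v → Σ[ j ∈ ℕ ] v ≡ r + j × Light r j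
  pruned⇒light {v} v∈U kept with j , refl ← offset (proj₁ v∈U) = j , refl , light
    where
    light : Light r j
    light i 0<i i≤j with i + cval s (r + i) <? c
    ... | yes light-i = light-i
    ... | no heavy-i
      with y , y∈U , r<y , Py≡r , y↝v ← U.rootChild-ancestor v∈U (m<m+n r (<-≤-trans 0<i i≤j)) =
      ⊥-elim (kept y y∈U (<⇒≢ r<y ∘ sym) Py≡r y-heavy y↝v)
      where
      r+i≯y = U.rootChild-not-lighter r<y Py≡r y↝v (r + i) (m<m+n r 0<i) (+-monoʳ-≤ r i≤j)
      y-heavy : wt s r y ≥W c
      y-heavy = gtW-≯⇒≥W (wt s r y) (subst (λ w → gtW w (wt s r y) ≡ false) (wt-U i 0<i) r+i≯y)
                          (≮⇒≥ heavy-i)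

  light⇒kept : ∀ {j} → Light r j → Kept (r + j)
  light⇒kept {j} light y y∈U y≢r Py≡r y-heavy y↝r+j
    with i , 0<i , refl ← offset-pos (≤∧≢⇒< (proj₁ y∈U) (y≢r ∘ sym)) =
    <⇒≱ (light i 0<i (+-cancelˡ-≤ r i j (proj₁ (U.desc⇒dominates y↝r+j))))
        (subst (_≥W c) (wt-U i 0<i) y-heavy)

  light-r⇒light-p : ∀ {j} → Agree j → Light r j → Light p j
  light-r⇒light-p agree light i 0<i i≤j rewrite sym (proj₂ (proj₂ (agree i 0<i i≤j))) = light i 0<i i≤j

  agree⇒<e′ : ∀ {j} → Agree j → r + j < e′
  agree⇒<e′ {j} agree = <nextIrr r (r + j) r<n inside
    where
    inside : ∀ w → r < w → w ≤ r + j → w < n × irrPos s w ≡ false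
    inside w r<w w≤r+j with i , 0<i , refl ← offset-pos r<w =
      proj₁ (agree i 0<i (+-cancelˡ-≤ r i j w≤r+j)) , proj₁ (proj₂ (agree i 0<i (+-cancelˡ-≤ r i j w≤r+j)))

  >ʷ-shift : ∀ {j} → Agree j → Light p j → ∀ a b → a ≤ j → 0 < b → b ≤ j →
             (r + a U.>ʷ r + b) ≡ (p + a T.>ʷ p + b)
  >ʷ-shift agree light zero b _ 0<b b≤j rewrite +-identityʳ r | +-identityʳ p =
    trans (U.root->ʷ (r + b) (<⇒≢ (m<m+n r 0<b) ∘ sym)) (sym (trans (>ʷ-T-p b) (<ᵇ-true (light b 0<b b≤j))))
  >ʷ-shift agree light (suc a) b 1+a≤j 0<b b≤j
    rewrite >ʷ-U (suc a) b z<s 0<b | >ʷ-T (suc a) b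
          | proj₂ (proj₂ (agree (suc a) z<s 1+a≤j)) | proj₂ (proj₂ (agree b 0<b b≤j)) = refl

  isParent-shift : ∀ {j k} → Agree j → Light p j → T.IsParent (p + k) (p + j) → U.IsParent (r + k) (r + j)
  isParent-shift {j} {k} agree light isP = record
    { root≤ = m≤m+n r k
    ; <child = +-monoʳ-< r k<j
    ; heavier = trans (>ʷ-shift agree light k j (<⇒≤ k<j) 0<j ≤-refl) heavier
    ; lighter-between = between
    }
    where
    open T.IsParent isP
    k<j = +-cancelˡ-< p k j <child
    0<j = ≤-<-trans z≤n k<j
    between : ∀ v → r + k < v → v < r + j → (v U.>ʷ r + j) ≡ false
    between v r+k<v v<r+j with i , refl ← offset (≤-trans (m≤m+n r k) (<⇒≤ r+k<v)) =
      trans (>ʷ-shift agree light i j (<⇒≤ i<j) 0<j ≤-refl)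
            (lighter-between (p + i) (+-monoʳ-< p (+-cancelˡ-< r k i r+k<v)) (+-monoʳ-< p i<j))
      where i<j = +-cancelˡ-< r i j v<r+j

  p≤parent : ∀ j → 0 < j → Light p j → p ≤ parentI s p′ (p + j)
  p≤parent j 0<j light = T.≤-parent p (p + j) (<-≤-trans p′<p (m≤m+n p j)) (m<m+n p 0<j)
    (trans (>ʷ-T-p j) (<ᵇ-true (light j 0<j ≤-refl)))

  parent-shift : ∀ j → 0 < j → Agree j → Light p j → parentI s r (r + j) ≡ r + (parentI s p′ (p + j) ∸ p)
  parent-shift j 0<j agree light with k , P≡p+k ← offset (p≤parent j 0<j light) rewrite P≡p+k | m+n∸m≡n p k =
    U.isParent-unique (U.parent-isParent (r + j) (m<m+n r 0<j))
      (isParent-shift agree light (subst (λ P → T.IsParent P (p + j)) P≡p+k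
        (T.parent-isParent (p + j) (<-≤-trans p′<p (m≤m+n p j)))))

  weight-shift : ∀ j → Agree j →
                 (if r + j ≡ᵇ r then wt s p′ p else addW d (wt s r (r + j))) ≡ wt s p′ (p + j)
  weight-shift zero _ rewrite +-identityʳ r | +-identityʳ p | ≡ᵇ-true {r} refl = refl
  weight-shift (suc i) agree = begin
    (if r + suc i ≡ᵇ r then wt s p′ p else addW d (wt s r (r + suc i)))
      ≡⟨ cong (if_then wt s p′ p else addW d (wt s r (r + suc i)))
              (≡ᵇ-false (<⇒≢ (m<m+n r (z<s {i})) ∘ sym)) ⟩
    addW d (wt s r (r + suc i))
      ≡⟨ cong (addW d) (wt-U (suc i) z<s) ⟩
    fin (d + (suc i + cval s (r + suc i)))
      ≡⟨ cong (λ x → fin (d + (suc i + x))) (proj₂ (proj₂ (agree (suc i) z<s ≤-refl))) ⟩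
    fin (d + (suc i + cval s (p + suc i)))
      ≡⟨ wt-T (suc i) ⟨
    wt s p′ (p + suc i) ∎
    where open ≡-Reasoning

  iso : Iso (subtree (I s p′) p) (prune (I s r) c d (wt s p′ p))
  iso = record
    { f = λ v → r + (v ∸ p)
    ; g = λ v → p + (v ∸ r)
    ; f-node = f-node
    ; g-node = g-node
    ; gf = gf
    ; fg = fg
    ; f-root = trans (cong (r +_) (n∸n≡0 p)) (+-identityʳ r)
    ; f-par = f-par
    ; f-wt = f-wt
    }
    where
    f-node : ∀ v → Node (subtree (I s p′) p) v → Node (prune (I s r) c d (wt s p′ p)) (r + (v ∸ p))
    f-node v (v∈T , p↝v) with j , refl , light ← subtree⇒light p↝v rewrite m+n∸m≡n p j =
      (m≤m+n r j , agree⇒<e′ agree) , light⇒kept (agree-light agree light)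
      where agree = shift-to-r j (proj₂ v∈T) light

    g-node : ∀ v → Node (prune (I s r) c d (wt s p′ p)) v → Node (subtree (I s p′) p) (p + (v ∸ r))
    g-node v (v∈U , kept) with j , refl , light ← pruned⇒light v∈U kept rewrite m+n∸m≡n r j
      with p+j<e , agree ← shift-to-p j (proj₂ v∈U) light =
      (≤-trans p′≤p (m≤m+n p j) , p+j<e) , light⇒subtree j p+j<e (light-r⇒light-p agree light)

    gf : ∀ v → Node (subtree (I s p′) p) v → p + (r + (v ∸ p) ∸ r) ≡ v
    gf v (_ , p↝v) with j , refl , _ ← subtree⇒light p↝v rewrite m+n∸m≡n p j | m+n∸m≡n r j = refl

    fg : ∀ v → Node (prune (I s r) c d (wt s p′ p)) v → r + (p + (v ∸ r) ∸ p) ≡ v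
    fg v (v∈U , kept) with j , refl , _ ← pruned⇒light v∈U kept rewrite m+n∸m≡n r j | m+n∸m≡n p j = refl

    f-par : ∀ v → Node (subtree (I s p′) p) v → v ≢ p →
            parentI s r (r + (v ∸ p)) ≡ r + (parentI s p′ v ∸ p)
    f-par v (v∈T , p↝v) v≢p with j , refl , light ← subtree⇒light p↝v rewrite m+n∸m≡n p j =
      parent-shift j 0<j (shift-to-r j (proj₂ v∈T) light) light
      where 0<j = n≢0⇒n>0 λ j≡0 → v≢p (trans (cong (p +_) j≡0) (+-identityʳ p))

    f-wt : ∀ v → Node (subtree (I s p′) p) v →
           (if r + (v ∸ p) ≡ᵇ r then wt s p′ p else addW d (wt s r (r + (v ∸ p)))) ≡ wt s p′ v
    f-wt v (v∈T , p↝v) with j , refl , light ← subtree⇒light p↝v rewrite m+n∸m≡n p j =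
      weight-shift j (shift-to-r j (proj₂ v∈T) light)

lemma8 : (s : List ℕ) → 1 ≤ length s →
         (∀ i → suc i < length s → at s (length s ∸ 1) < at s i) →
         ∀ p' → p' < length s → irrPos s p' ≡ true →
         ∀ p → p' < p → Node (I s p') p → irrPos s p ≡ false →
         Iso (subtree (I s p') p)
             (prune (I s (closest s p)) (lcp s (closest s p) p) (p ∸ p') (weight (I s p') p))
lemma8 s _ _ p′ p′<n _ p p′<p p∈I p-reducible = SubtreeIso.iso s p′ p′<n p p′<p p∈I p-reducible
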